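{- Let $(G,\sigma)$ and $(G,\pi)$ be signed graphs on the same graph $G$. If $(G,\sigma)$ and $(G,\pi)$ are switching equivalent, then $C_r(G,\sigma)=C_r(G,\pi)$.
   Context: A signed graph $(G,\sigma)$ is a finite simple graph $G$ with a map $\sigma\colon E(G)\to\{+,-\}$ ($\{\pm\}$ viewed as a multiplicative group). Switching at $X\subseteq V(G)$ reverses the signs of all edges with exactly one end in $X$; $(G,\sigma)$ and $(G,\pi)$ are switching equivalent if one is obtained from the other by switching at some vertex set. Relaxed information dissemination (rID) process on $(G,\sigma)$: each vertex has a state in $\{A,-A,C,0\}$, initially all $0$. In step $i\geq 1$: choose a vertex $v_i$ of state $0$ (a placement vertex) and set its state to $A$ or to $-A$ (either choice allowed). Then, simultaneously for every vertex $v$ currently in state $0$, consider its neighbours $z$ currently in state $A$ or $-A$ (states after placing $v_i$, before this step's updates); each such $z$ sends $\sigma(vz)\cdot\mathrm{state}(z)$ (with $-(-A)=A$). If $v$ has no such neighbour it stays $0$; if all sent values are equal, $v$ takes that value; if two sent values differ, $v$ gets state $C$ (confused). Vertices with state $A$, $-A$ or $C$ keep their state. Repeat until no vertex has state $0$. The value of the run is the number of vertices of final state $C$. The relaxed confusion number $C_r(G,\sigma)$ is the minimum value over all possible runs. -}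

module Defs where

open import Data.Nat using (ℕ; zero; suc; _≤_)
open import Data.Fin using (Fin; _≟_)
open import Data.Bool using (Bool; true; false; if_then_else_; _xor_)
open import Data.Sign using (Sign; opposite) renaming (_*_ to _·_)
open import Data.List using (List; foldr; map; allFin)
open import Data.Nat.ListAction using (sum)
open import Data.Product using (Σ; _×_; ∃)
open import Relation.Nullary using (¬_; yes; no)
open import Relation.Binary.PropositionalEquality using (_≡_)

record Graph (n : ℕ) : Set where
  field
    adj     : Fin n → Fin n → Bool
    symm    : ∀ u v → adj u v ≡ adj v u
    irrefl  : ∀ v → adj v v ≡ false
open Graph public

-- A signature σ : E(G) → {+,-}, represented as a function on pairs of
-- vertices which is symmetric on edges (values on non-edges are irrelevant).
record Signature {n : ℕ} (G : Graph n) : Set where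
  field
    sgn      : Fin n → Fin n → Sign
    sgn-symm : ∀ u v → adj G u v ≡ true → sgn u v ≡ sgn v u
open Signature public

switch : ∀ {n} → (Fin n → Bool) → (Fin n → Fin n → Sign) → Fin n → Fin n → Sign
switch X s u v = if X u xor X v then opposite (s u v) else s u v

SwitchingEquivalent : ∀ {n} (G : Graph n) → Signature G → Signature G → Set
SwitchingEquivalent {n} G σ π =
  Σ (Fin n → Bool) λ X → ∀ u v → adj G u v ≡ true → sgn π u v ≡ switch X (sgn σ) u v

-- Vertex states: A (informed ε·A for ε ∈ {+,-}), C (confused), 0 (zero).
data State : Set where
  inf  : Sign → State
  conf : State
  zer  : State

Config : ℕ → Set
Config n = Fin n → State

data Msg : Set where
  none  : Msg
  val   : Sign → Msg
  clash : Msg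

addMsg : Sign → Msg → Msg
addMsg s none = val s
addMsg s (val t) with s Data.Sign.≟ t
... | yes _ = val t
... | no  _ = clash
addMsg s clash = clash

sendTo : ∀ {n} (G : Graph n) → (Fin n → Fin n → Sign) → Config n → Fin n → Fin n → Msg → Msg
sendTo G s c u z m with adj G u z | c z
... | true | inf e = addMsg (s u z · e) m
... | _    | _     = m

collect : ∀ {n} (G : Graph n) → (Fin n → Fin n → Sign) → Config n → Fin n → Msg
collect {n} G s c u = foldr (sendTo G s c u) none (allFin n)

msgState : Msg → State
msgState none    = zer
msgState (val e) = inf e
msgState clash   = conf

update : ∀ {n} (G : Graph n) → (Fin n → Fin n → Sign) → Config n → Config n
update G s c u with c u
... | zer = msgState (collect G s c u)
... | st  = st

place : ∀ {n} → Config n → Fin n → Sign → Config n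
place c v e u with u ≟ v
... | yes _ = inf e
... | no  _ = c u

stepConfig : ∀ {n} (G : Graph n) → (Fin n → Fin n → Sign) → Config n → Fin n → Sign → Config n
stepConfig G s c v e = update G s (place c v e)

isConf : State → ℕ
isConf conf = 1
isConf _    = 0

countConf : ∀ {n} → Config n → ℕ
countConf {n} c = sum (map (λ v → isConf (c v)) (allFin n))

data RunFrom {n : ℕ} (G : Graph n) (σ : Signature G) : Config n → ℕ → Set where
  done  : ∀ {c} → (∀ v → ¬ (c v ≡ zer)) → RunFrom G σ c (countConf c)
  step  : ∀ {c k} (v : Fin n) (e : Sign) → c v ≡ zer →
          RunFrom G σ (stepConfig G (sgn σ) c v e) k → RunFrom G σ c k

initial : ∀ {n} → Config n
initial _ = zer

RunValue : ∀ {n} (G : Graph n) → Signature G → ℕ → Set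
RunValue G σ k = RunFrom G σ initial k

IsCr : ∀ {n} (G : Graph n) → Signature G → ℕ → Set
IsCr G σ m = RunValue G σ m × (∀ k → RunValue G σ k → m ≤ k)

{-# OPTIONS --safe #-}
module Submission where

open import Defs
open import Data.Nat using (ℕ)
open import Data.Bool using (Bool; true; false; if_then_else_; _xor_)
open import Data.Sign using (Sign; +; -; opposite) renaming (_*_ to _·_; _≟_ to _≟ₛ_)
open import Data.Sign.Properties using (*-assoc; *-cancelˡ-≡; opposite-involutive)
open import Data.Fin using (Fin; _≟_)
open import Data.List using (allFin)
open import Data.List.Properties using (map-cong; foldr-cong; foldr-fusion)
open import Data.Nat.ListAction using (sum)
open import Data.Product using (_,_)
open import Function using (_∘_)
open import Function.Bundles using (_⇔_; mk⇔)
open import Relation.Nullary using (yes; no; contradiction)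
open import Relation.Binary.PropositionalEquality

-- Switching at X multiplies the sign of uv by τ u · τ v, where τ u = - exactly when u ∈ X.
-- The rID process is equivariant under the matching action on configurations, which
-- multiplies the state ±A of each vertex u by τ u: a message z sends to u changes by
-- (τ u · τ z) · τ z = τ u, so agreement and disagreement at u are preserved, placements
-- correspond to placements and confusion is untouched.  So every run on (G,σ) yields a run
-- on (G,π) with the same value, and switching back at X gives the converse.

toSign : Bool → Sign
toSign true  = -
toSign false = +

switch-as-product : ∀ {n} (X : Fin n → Bool) (s : Fin n → Fin n → Sign) u v →
  switch X s u v ≡ toSign (X u) · toSign (X v) · s u v
switch-as-product X s u v with X u | X v
... | true  | true  = refl
... | true  | false = refl
... | false | true  = refl
... | false | false = refl

switch-involutive : ∀ {n} (X : Fin n → Bool) (s : Fin n → Fin n → Sign) u v →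
  switch X (switch X s) u v ≡ s u v
switch-involutive X s u v with X u xor X v
... | true  = opposite-involutive (s u v)
... | false = refl

SwitchingEquivalent-sym : ∀ {n} (G : Graph n) (σ π : Signature G) →
  SwitchingEquivalent G σ π → SwitchingEquivalent G π σ
SwitchingEquivalent-sym G σ π (X , π≡Xσ) = X , λ u v uv →
  begin
    sgn σ u v                       ≡⟨ switch-involutive X (sgn σ) u v ⟨
    switch X (switch X (sgn σ)) u v ≡⟨ cong (λ t → if X u xor X v then opposite t else t) (π≡Xσ u v uv) ⟨
    switch X (sgn π) u v            ∎
  where open ≡-Reasoning

·-cancel-middle : ∀ a b s e → (a · b · s) · (b · e) ≡ a · (s · e)
·-cancel-middle a b s e =
  begin
    a · b · s · (b · e)   ≡⟨ cong (_· (b · e)) (*-assoc a b s) ⟩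
    a · (b · s) · (b · e) ≡⟨ *-assoc a (b · s) (b · e) ⟩
    a · (b · s · (b · e)) ≡⟨ cong (a ·_) (cancel b s) ⟩
    a · (s · e)           ∎
  where
  open ≡-Reasoning
  cancel : ∀ b s → b · s · (b · e) ≡ s · e
  cancel + s = refl
  cancel - + = opposite-involutive e
  cancel - - = refl

switchState : Sign → State → State
switchState t (inf e) = inf (t · e)
switchState t conf    = conf
switchState t zer     = zer

switchMsg : Sign → Msg → Msg
switchMsg t none    = none
switchMsg t (val e) = val (t · e)
switchMsg t clash   = clash

switchConfig : ∀ {n} → (Fin n → Bool) → Config n → Config n
switchConfig X c u = switchState (toSign (X u)) (c u)

switchMsg-addMsg : ∀ t s m → switchMsg t (addMsg s m) ≡ addMsg (t · s) (switchMsg t m)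
switchMsg-addMsg t s none  = refl
switchMsg-addMsg t s clash = refl
switchMsg-addMsg t s (val r) with s ≟ₛ r | t · s ≟ₛ t · r
... | yes refl | yes _     = refl
... | yes refl | no ts≢ts  = contradiction refl ts≢ts
... | no s≢r   | yes ts≡tr = contradiction (*-cancelˡ-≡ t s r ts≡tr) s≢r
... | no _     | no _      = refl

msgState-switch : ∀ t m → msgState (switchMsg t m) ≡ switchState t (msgState m)
msgState-switch t none    = refl
msgState-switch t (val e) = refl
msgState-switch t clash   = refl

isConf-switch : ∀ t s → isConf (switchState t s) ≡ isConf s
isConf-switch t (inf e) = refl
isConf-switch t conf    = refl
isConf-switch t zer     = refl

switchState-≡zer : ∀ t s → switchState t s ≡ zer → s ≡ zer
switchState-≡zer t zer _ = refl

countConf-cong : ∀ {n} {c c′ : Config n} →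
  (∀ v → isConf (c v) ≡ isConf (c′ v)) → countConf c ≡ countConf c′
countConf-cong {n} same = cong sum (map-cong same (allFin n))

place-cong : ∀ {n} {c c′ : Config n} → c ≗ c′ → ∀ v e → place c v e ≗ place c′ v e
place-cong c≗c′ v e u with u ≟ v
... | yes _ = refl
... | no  _ = c≗c′ u

module _ {n} (G : Graph n) (s : Fin n → Fin n → Sign) {c c′ : Config n} (c≗c′ : c ≗ c′) where

  sendTo-cong : ∀ u z m → sendTo G s c u z m ≡ sendTo G s c′ u z m
  sendTo-cong u z m with adj G u z | c z | c′ z | c≗c′ z
  ... | true  | inf e | _ | refl = refl
  ... | true  | conf  | _ | refl = refl
  ... | true  | zer   | _ | refl = refl
  ... | false | _     | _ | _    = refl

  update-cong : update G s c ≗ update G s c′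
  update-cong u with c u | c′ u | c≗c′ u
  ... | inf e | _ | refl = refl
  ... | conf  | _ | refl = refl
  ... | zer   | _ | refl = cong msgState (foldr-cong (sendTo-cong u) refl (allFin n))

-- Without function extensionality, a step from a switched configuration agrees with the
-- switched step only pointwise; runs transfer along such pointwise equalities.
RunFrom-cong : ∀ {n} {G : Graph n} {σ : Signature G} {c c′ : Config n} {k} →
  c ≗ c′ → RunFrom G σ c k → RunFrom G σ c′ k
RunFrom-cong {G = G} {σ} {c′ = c′} c≗c′ (done no-zer) =
  subst (RunFrom G σ c′) (countConf-cong (cong isConf ∘ sym ∘ c≗c′))
    (done λ v c′v≡zer → no-zer v (trans (c≗c′ v) c′v≡zer))
RunFrom-cong {G = G} {σ} c≗c′ (step v e cv≡zer run) =
  step v e (trans (sym (c≗c′ v)) cv≡zer)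
    (RunFrom-cong (update-cong G (sgn σ) (place-cong c≗c′ v e)) run)

module _ {n} (G : Graph n) (σ π : Signature G) (X : Fin n → Bool)
         (π≡Xσ : ∀ u v → adj G u v ≡ true → sgn π u v ≡ switch X (sgn σ) u v) where

  private
    τ : Fin n → Sign
    τ = toSign ∘ X

  sendTo-switch : ∀ (c : Config n) u z m →
    switchMsg (τ u) (sendTo G (sgn σ) c u z m) ≡
    sendTo G (sgn π) (switchConfig X c) u z (switchMsg (τ u) m)
  sendTo-switch c u z m with adj G u z in uz | c z
  ... | true  | inf e =
    begin
      switchMsg (τ u) (addMsg (sgn σ u z · e) m)            ≡⟨ switchMsg-addMsg (τ u) _ m ⟩
      addMsg (τ u · (sgn σ u z · e)) (switchMsg (τ u) m)    ≡⟨ cong (λ t → addMsg t (switchMsg (τ u) m)) sign-of-message ⟩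
      addMsg (sgn π u z · (τ z · e)) (switchMsg (τ u) m)    ∎
    where
    open ≡-Reasoning
    sign-of-message : τ u · (sgn σ u z · e) ≡ sgn π u z · (τ z · e)
    sign-of-message =
      begin
        τ u · (sgn σ u z · e)               ≡⟨ ·-cancel-middle (τ u) (τ z) (sgn σ u z) e ⟨
        τ u · τ z · sgn σ u z · (τ z · e)   ≡⟨ cong (_· (τ z · e)) (switch-as-product X (sgn σ) u z) ⟨
        switch X (sgn σ) u z · (τ z · e)    ≡⟨ cong (_· (τ z · e)) (π≡Xσ u z uz) ⟨
        sgn π u z · (τ z · e)               ∎
  ... | true  | conf = refl
  ... | true  | zer  = refl
  ... | false | _    = refl

  update-switch : ∀ (c : Config n) u →
    switchState (τ u) (update G (sgn σ) c u) ≡ update G (sgn π) (switchConfig X c) u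
  update-switch c u with c u
  ... | inf e = refl
  ... | conf  = refl
  ... | zer   =
    begin
      switchState (τ u) (msgState (collect G (sgn σ) c u))      ≡⟨ msgState-switch (τ u) _ ⟨
      msgState (switchMsg (τ u) (collect G (sgn σ) c u))        ≡⟨ cong msgState (foldr-fusion (switchMsg (τ u)) none (sendTo-switch c u) (allFin n)) ⟩
      msgState (collect G (sgn π) (switchConfig X c) u)         ∎
    where open ≡-Reasoning

  place-switch : ∀ (c : Config n) v e →
    switchConfig X (place c v e) ≗ place (switchConfig X c) v (τ v · e)
  place-switch c v e u with u ≟ v
  ... | yes refl = refl
  ... | no  _    = refl

  stepConfig-switch : ∀ (c : Config n) v e →
    switchConfig X (stepConfig G (sgn σ) c v e) ≗ stepConfig G (sgn π) (switchConfig X c) v (τ v · e)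
  stepConfig-switch c v e u =
    trans (update-switch (place c v e) u) (update-cong G (sgn π) (place-switch c v e) u)

  RunFrom-switch : ∀ {c k} → RunFrom G σ c k → RunFrom G π (switchConfig X c) k
  RunFrom-switch {c} (done no-zer) =
    subst (RunFrom G π (switchConfig X c)) (countConf-cong (λ v → isConf-switch (τ v) (c v)))
      (done λ v → no-zer v ∘ switchState-≡zer (τ v) (c v))
  RunFrom-switch (step v e cv≡zer run) =
    step v (τ v · e) (cong (switchState (τ v)) cv≡zer)
      (RunFrom-cong (stepConfig-switch _ v e) (RunFrom-switch run))

RunValue-switch : ∀ {n} (G : Graph n) (σ π : Signature G) →
  SwitchingEquivalent G σ π → ∀ {k} → RunValue G σ k → RunValue G π k
RunValue-switch G σ π (X , π≡Xσ) = RunFrom-switch G σ π X π≡Xσ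

IsCr-transfer : ∀ {n} (G : Graph n) (σ π : Signature G) {m} →
  (∀ {k} → RunValue G σ k → RunValue G π k) →
  (∀ {k} → RunValue G π k → RunValue G σ k) →
  IsCr G σ m → IsCr G π m
IsCr-transfer G σ π to from (run , minimal) = to run , λ k → minimal k ∘ from

lemma3p2 : ∀ {n} (G : Graph n) (σ π : Signature G) →
    SwitchingEquivalent G σ π → ∀ (m : ℕ) → IsCr G σ m ⇔ IsCr G π m
lemma3p2 G σ π σ~π m = mk⇔ (IsCr-transfer G σ π to from) (IsCr-transfer G π σ from to)
  where
  to : ∀ {k} → RunValue G σ k → RunValue G π k
  to = RunValue-switch G σ π σ~π
  from : ∀ {k} → RunValue G π k → RunValue G σ k
  from = RunValue-switch G π σ (SwitchingEquivalent-sym G σ π σ~π)
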